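{- Let $m,n\ge 1$ be integers and let $K_{n,n,\dots,n}$ be the complete $m$-partite graph with parts $V_1,\dots,V_m$, each of cardinality $n$ (vertices are adjacent iff they lie in different parts). Let $\mathcal{A}=\mathcal{A}_1\cup\cdots\cup\mathcal{A}_m$ be a disjoint union with $|\mathcal{A}_i|=n$, and let $\mathcal{W}_m(n)$ be the set of words $w=w_1\cdots w_{mn}$ over $\mathcal{A}$ such that each letter of $\mathcal{A}$ appears exactly once, consecutive letters lie in different sets $\mathcal{A}_i$, and the first and last letters lie in different sets $\mathcal{A}_i$; put $W_m(n)=|\mathcal{W}_m(n)|$. Let $S_m(n)$ be the number of words of length $mn$ over $[m]$ using each color exactly $n$ times, with no two consecutive equal letters and with distinct first and last letters. Then: (1) there is a bijection between $\mathcal{W}_m(n)$ and the directed Hamiltonian paths in $K_{n,n,\dots,n}$ whose two endpoints lie in distinct parts; (2) each undirected Hamiltonian cycle in $K_{n,n,\dots,n}$ corresponds to exactly $2mn$ such directed paths. Consequently, the number $H_m(n)$ of undirected Hamiltonian cycles in $K_{n,n,\dots,n}$ satisfies \[ H_m(n)=\frac{W_m(n)}{2mn}=\frac{(n!)^m}{2mn}\,S_m(n). \]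
   Context: A directed Hamiltonian path is a sequence $v_1,\dots,v_{mn}$ listing every vertex exactly once with $v_t v_{t+1}$ an edge for all $t$. -}

module Defs where

open import Level using (0ℓ)
open import Data.Nat using (ℕ; zero; suc; _*_; _∸_; _≤_)
open import Data.Fin using (Fin; toℕ)
open import Data.Bool using (Bool; true)
open import Data.Product using (Σ; ∃; ∃-syntax; _×_; _,_; proj₁)
open import Data.Sum using (_⊎_)
open import Data.Vec using (Vec; lookup; count)
open import Data.Fin.Properties using (_≟_)
open import Relation.Nullary using (¬_)
open import Relation.Binary using (Setoid)
open import Relation.Binary.PropositionalEquality using (_≡_; _≢_; refl; sym; trans)
open import Function.Bundles using (_⇔_)

EachOnce : {X : Set} {N : ℕ} → Vec X N → Set
EachOnce {X} {N} s =
  (∀ (i j : Fin N) → lookup s i ≡ lookup s j → i ≡ j) × (∀ (x : X) → ∃[ i ] lookup s i ≡ x)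

ConsecutiveRel : {X : Set} {N : ℕ} → (X → X → Set) → Vec X N → Set
ConsecutiveRel {X} {N} R s =
  ∀ (i j : Fin N) → toℕ j ≡ suc (toℕ i) → R (lookup s i) (lookup s j)

FirstLastRel : {X : Set} {N : ℕ} → (X → X → Set) → Vec X N → Set
FirstLastRel {X} {N} R s =
  ∀ (i j : Fin N) → toℕ i ≡ 0 → toℕ j ≡ N ∸ 1 → R (lookup s i) (lookup s j)

Vertex : ℕ → ℕ → Set
Vertex m n = Fin m × Fin n

part : {m n : ℕ} → Vertex m n → Fin m
part = proj₁

Adj : {m n : ℕ} → Vertex m n → Vertex m n → Set
Adj u v = part u ≢ part v

DiffPart : {m n : ℕ} → Vertex m n → Vertex m n → Set
DiffPart u v = part u ≢ part v

IsDirHamPath : (m n : ℕ) → Vec (Vertex m n) (m * n) → Set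
IsDirHamPath m n p = EachOnce p × ConsecutiveRel Adj p

-- directed Hamiltonian paths whose two endpoints lie in distinct parts
-- (the proof component is irrelevant: equality of paths = equality of sequences)
record DPath (m n : ℕ) : Set where
  constructor mkDPath
  field
    path : Vec (Vertex m n) (m * n)
    .isPath : IsDirHamPath m n path
    .endsDiff : FirstLastRel DiffPart path

-- Undirected Hamiltonian cycles, as subgraphs (edge sets).

IsHamCyclicSeq : (m n : ℕ) → Vec (Vertex m n) (m * n) → Set
IsHamCyclicSeq m n c =
  3 ≤ m * n × EachOnce c × ConsecutiveRel Adj c × FirstLastRel (λ u v → Adj v u) c

CycleEdge : (m n : ℕ) → Vec (Vertex m n) (m * n) → Vertex m n → Vertex m n → Set
CycleEdge m n c u v =
  ∃[ i ] ∃[ j ]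
    ((toℕ j ≡ suc (toℕ i)) ⊎ (toℕ i ≡ m * n ∸ 1 × toℕ j ≡ 0)) ×
    ((lookup c i ≡ u × lookup c j ≡ v) ⊎ (lookup c i ≡ v × lookup c j ≡ u))

IsHamCycleEdgeSet : (m n : ℕ) → (Vertex m n → Vertex m n → Bool) → Set
IsHamCycleEdgeSet m n E =
  ∃[ c ] IsHamCyclicSeq m n c × (∀ u v → (E u v ≡ true) ⇔ CycleEdge m n c u v)

record HamCycle (m n : ℕ) : Set where
  constructor mkHamCycle
  field
    edges : Vertex m n → Vertex m n → Bool
    .isCycle : IsHamCycleEdgeSet m n edges

open HamCycle public

_≈C_ : {m n : ℕ} → HamCycle m n → HamCycle m n → Set
C ≈C D = ∀ u v → edges C u v ≡ edges D u v

HamCycleSetoid : ℕ → ℕ → Setoid 0ℓ 0ℓ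
HamCycleSetoid m n = record
  { Carrier = HamCycle m n
  ; _≈_ = _≈C_
  ; isEquivalence = record
    { refl = λ u v → refl
    ; sym = λ p u v → sym (p u v)
    ; trans = λ p q u v → trans (p u v) (q u v)
    }
  }

record Fiber {m n : ℕ} (f : DPath m n → HamCycle m n) (C : HamCycle m n) : Set where
  constructor mkFiber
  field
    point : DPath m n
    .over : f point ≈C C

-- Words.  The alphabet 𝒜 = 𝒜_1 ∪ ... ∪ 𝒜_m with |𝒜_i| = n is modelled as
-- Fin m × Fin n, letter (i , k) being the k-th letter of 𝒜_i.

Letter : ℕ → ℕ → Set
Letter m n = Fin m × Fin n

class : {m n : ℕ} → Letter m n → Fin m
class = proj₁

DiffClass : {m n : ℕ} → Letter m n → Letter m n → Set
DiffClass a b = class a ≢ class b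

record Word (m n : ℕ) : Set where
  constructor mkWord
  field
    letters : Vec (Letter m n) (m * n)
    .eachOnce : EachOnce letters
    .consec : ConsecutiveRel DiffClass letters
    .firstLast : FirstLastRel DiffClass letters

record ColourWord (m n : ℕ) : Set where
  constructor mkColourWord
  field
    colours : Vec (Fin m) (m * n)
    .eachN : ∀ (c : Fin m) → count (_≟ c) colours ≡ n
    .consec : ConsecutiveRel _≢_ colours
    .firstLast : FirstLastRel _≢_ colours

-- Part (1) is a repackaging: a word of 𝒲_m(n) is literally a directed Hamiltonian path of
-- K_{n,…,n} whose ends lie in distinct parts.  Such a path closes up to a Hamiltonian cycle,
-- since mn ≥ 3 (this is why K_{1,1} is excluded).  Conversely, an injective walk along the
-- edges of a cycle of length N ≥ 3 can never turn back, so it is determined by its first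
-- vertex and its direction: every cycle is the closure of exactly 2mn paths, the images of a
-- fixed one under the dihedral group acting on positions.  Summing over cycles gives
-- W = 2mn·H.  Finally a word is the same as its colour word together with, for every colour i,
-- the order in which the n letters of 𝒜_i occur, an arrangement of Fin n; hence W = (n!)^m·S.

module Submission where

open import Defs
open import Data.Nat using (ℕ; zero; suc; _+_; _*_; _∸_; _^_; _!; _≤_; _<_; z≤n; s≤s; _≤?_; _<?_)
open import Data.Nat.Properties
  using (+-comm; +-assoc; +-suc; +-identityʳ; *-assoc; *-comm; *-mono-≤; n≮n; <-irrefl; <⇒≤; ≤-refl;
         ≤-pred; ≤-antisym; ≮⇒≥; ≤-trans; ≤-reflexive; m+[n∸m]≡n; m∸n≤m; n∸n≡0; +-∸-assoc)
open import Data.Nat.DivMod using (_%_; m%n<n; m<n⇒m%n≡m; %-distribˡ-+; m%n%n≡m%n; [m+n]%n≡m%n; n%n≡0)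
open import Data.Bool using (Bool; true; false)
import Data.Bool as Bool
open import Data.Fin using (Fin; zero; suc; toℕ; fromℕ; fromℕ<; opposite; punchIn; punchOut)
open import Data.Fin.Properties
  using (_≟_; any?; all?; <-cmp; *↔×; injective⇒≤; toℕ-fromℕ; toℕ-fromℕ<; toℕ-injective; toℕ<n;
         opposite-prop; opposite-involutive; 0≢1+n; suc-injective; punchInᵢ≢i; punchIn-injective;
         punchOut-injective; punchIn-punchOut; punchOut-punchIn; punchOut-cong)
open import Data.Fin.Permutation using (↔⇒≡)
open import Data.Vec using (Vec; []; _∷_; lookup; tabulate; map; count)
open import Data.Vec.Properties using (lookup-map; lookup∘tabulate; tabulate∘lookup; tabulate-cong)
import Data.Vec.Properties as Vec
open import Data.Product using (Σ; ∃; _×_; _,_; proj₁; proj₂; uncurry)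
import Data.Product.Properties as Product
open import Data.Product.Function.NonDependent.Propositional using (_×-↔_)
open import Data.Product.Function.Dependent.Propositional using (Σ-↔)
open import Data.Sum using (_⊎_; inj₁; inj₂)
open import Data.Empty using (⊥-elim)
import Data.Empty.Irrelevant as Irr
open import Relation.Nullary using (¬_; Dec; yes; no; does; Irrelevant)
open import Relation.Nullary.Decidable
  using (map′; recompute; _×-dec_; _⊎-dec_; _→-dec_; ¬?; dec-true; dec-false; does-⇔)
open import Relation.Unary using (Decidable)
open import Relation.Binary using (DecidableEquality; tri<; tri≈; tri>)
open import Relation.Binary.PropositionalEquality
import Axiom.UniquenessOfIdentityProofs as UIP
open import Function using (_∘_)
open import Function.Bundles using (_↔_; _⇔_; mk↔ₛ′; mk⇔; Equivalence; Inverse)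
open import Function.Properties.Inverse using (↔-refl; ↔-sym)
open import Function.Construct.Symmetry using (⇔-sym)
open import Function.Construct.Composition using (_↔-∘_; _⇔-∘_)

open Inverse using (to; from; strictlyInverseˡ; strictlyInverseʳ)

≗-lookup⇒≡ : ∀ {A : Set} {k} (u v : Vec A k) → (∀ i → lookup u i ≡ lookup v i) → u ≡ v
≗-lookup⇒≡ u v e = trans (sym (tabulate∘lookup u)) (trans (tabulate-cong e) (tabulate∘lookup v))

Fin-*-↔ : ∀ {a b} {X Y : Set} → Fin a ↔ X → Fin b ↔ Y → Fin (a * b) ↔ (X × Y)
Fin-*-↔ f g = (f ×-↔ g) ↔-∘ *↔×

Vec-∷-↔ : ∀ {A : Set} {m} → (A × Vec A m) ↔ Vec A (suc m)
Vec-∷-↔ = mk↔ₛ′ (uncurry _∷_) (λ { (a ∷ v) → a , v }) (λ { (a ∷ v) → refl }) (λ _ → refl)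

Fin-^-↔ : ∀ {k} {A : Set} → Fin k ↔ A → ∀ m → Fin (k ^ m) ↔ Vec A m
Fin-^-↔ f zero    = mk↔ₛ′ (λ _ → []) (λ _ → zero) (λ { [] → refl }) (λ { zero → refl })
Fin-^-↔ f (suc m) = Vec-∷-↔ ↔-∘ Fin-*-↔ f (Fin-^-↔ f m)

↔-card : ∀ {a b} {X : Set} → Fin a ↔ X → Fin b ↔ X → a ≡ b
↔-card f g = ↔⇒≡ (↔-sym g ↔-∘ f)

-- If x were missed, punching it out would inject Fin N into Fin (N ∸ 1).
injective⇒surjective : ∀ {N} {X : Set} → Fin N ↔ X → (g : Fin N → X) → (∀ i j → g i ≡ g j → i ≡ j) →
                       ∀ x → ∃ λ i → g i ≡ x
injective⇒surjective {zero}  e g inj x with () ← from e x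
injective⇒surjective {suc N} e g inj x with any? (λ i → from e (g i) ≟ from e x)
... | yes (i , hit) = i , trans (sym (strictlyInverseˡ e (g i))) (trans (cong (to e) hit) (strictlyInverseˡ e x))
... | no miss = ⊥-elim (n≮n N (injective⇒≤ {f = squeeze} squeeze-injective))
  where
  y≢g : ∀ i → from e x ≢ from e (g i)
  y≢g i eq = miss (i , sym eq)
  squeeze : Fin (suc N) → Fin N
  squeeze i = punchOut (y≢g i)
  squeeze-injective : ∀ {i j} → squeeze i ≡ squeeze j → i ≡ j
  squeeze-injective {i} {j} eq = inj i j (trans (sym (strictlyInverseˡ e (g i)))
    (trans (cong (to e) (punchOut-injective (y≢g i) (y≢g j) eq)) (strictlyInverseˡ e (g j))))

module _ {a} {X : Set} (e : Fin a ↔ X) {Q : X → Set} (Q? : Decidable Q) where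

  ↔-any? : Dec (∃ Q)
  ↔-any? = map′ (λ (i , q) → to e i , q) (λ (x , q) → from e x , subst Q (sym (strictlyInverseˡ e x)) q)
                (any? (Q? ∘ to e))

  ↔-all? : Dec (∀ x → Q x)
  ↔-all? = map′ (λ f x → subst Q (strictlyInverseˡ e x) (f (from e x))) (λ f i → f (to e i))
                (all? (Q? ∘ to e))

module _ {A : Set} {P : A → Set} (P? : Decidable P) (P-irrelevant : ∀ {x} → Irrelevant (P x)) where

  Fin-count-↔ : ∀ {L} (v : Vec A L) → Fin (count P? v) ↔ Σ (Fin L) (λ i → P (lookup v i))
  Fin-count-↔ [] = mk↔ₛ′ (λ ()) (λ { (() , _) }) (λ { (() , _) }) (λ ())
  Fin-count-↔ (x ∷ xs) with P? x | Fin-count-↔ xs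
  ... | yes px | rest = mk↔ₛ′ to′ from′ to∘from from∘to
    where
    to′ : Fin (suc (count P? xs)) → Σ (Fin _) (λ i → P (lookup (x ∷ xs) i))
    to′ zero    = zero , px
    to′ (suc j) = suc (proj₁ (to rest j)) , proj₂ (to rest j)
    from′ : Σ (Fin _) (λ i → P (lookup (x ∷ xs) i)) → Fin (suc (count P? xs))
    from′ (zero , _)  = zero
    from′ (suc i , p) = suc (from rest (i , p))
    to∘from : ∀ y → to′ (from′ y) ≡ y
    to∘from (zero , p)  = cong (zero ,_) (P-irrelevant px p)
    to∘from (suc i , p) = cong (λ { (a , b) → suc a , b }) (strictlyInverseˡ rest (i , p))
    from∘to : ∀ y → from′ (to′ y) ≡ y
    from∘to zero    = refl
    from∘to (suc j) = cong suc (strictlyInverseʳ rest j)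
  ... | no ¬px | rest = mk↔ₛ′ to′ from′ to∘from (strictlyInverseʳ rest)
    where
    to′ : Fin (count P? xs) → Σ (Fin _) (λ i → P (lookup (x ∷ xs) i))
    to′ j = suc (proj₁ (to rest j)) , proj₂ (to rest j)
    from′ : Σ (Fin _) (λ i → P (lookup (x ∷ xs) i)) → Fin (count P? xs)
    from′ (zero , p)  = ⊥-elim (¬px p)
    from′ (suc i , p) = from rest (i , p)
    to∘from : ∀ y → to′ (from′ y) ≡ y
    to∘from (zero , p)  = ⊥-elim (¬px p)
    to∘from (suc i , p) = cong (λ { (a , b) → suc a , b }) (strictlyInverseˡ rest (i , p))

record Arrangement (n : ℕ) : Set where
  constructor mkArrangement
  field
    vec : Vec (Fin n) n
    .injective : ∀ i j → lookup vec i ≡ lookup vec j → i ≡ j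

arrangement-≡ : ∀ {n} {u v : Vec (Fin n) n} .{iu iv} → u ≡ v → mkArrangement u iu ≡ mkArrangement v iv
arrangement-≡ refl = refl

arrangement-injective : ∀ {n} (π : Arrangement n) i j →
                        lookup (Arrangement.vec π) i ≡ lookup (Arrangement.vec π) j → i ≡ j
arrangement-injective (mkArrangement v inj) i j e = recompute (i ≟ j) (inj i j e)

-- An arrangement of Fin (suc n) is its head x followed by an arrangement of the
-- remaining values, renumbered into Fin n by punchOut x.
module _ (n : ℕ) where

  private
    head-fresh : ∀ {x} {xs : Vec (Fin (suc n)) n} →
                 .(∀ i j → lookup (x ∷ xs) i ≡ lookup (x ∷ xs) j → i ≡ j) → ∀ i → x ≢ lookup xs i
    head-fresh inj i e = Irr.⊥-elim (0≢1+n (inj zero (suc i) e))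

    renumberedTail : ∀ {x} {xs : Vec (Fin (suc n)) n} →
                     .(∀ i j → lookup (x ∷ xs) i ≡ lookup (x ∷ xs) j → i ≡ j) → Vec (Fin n) n
    renumberedTail inj = tabulate (λ i → punchOut (head-fresh inj i))

    cons : Fin (suc n) × Arrangement n → Arrangement (suc n)
    cons (x , mkArrangement ys inj) = mkArrangement (x ∷ map (punchIn x) ys) inj′
      where
      lookup-punchIn : ∀ i → lookup (map (punchIn x) ys) i ≡ punchIn x (lookup ys i)
      lookup-punchIn i = lookup-map i (punchIn x) ys
      inj′ : ∀ i j → lookup (x ∷ map (punchIn x) ys) i ≡ lookup (x ∷ map (punchIn x) ys) j → i ≡ j
      inj′ zero    zero    e = refl
      inj′ zero    (suc j) e = ⊥-elim (punchInᵢ≢i x (lookup ys j) (trans (sym (lookup-punchIn j)) (sym e)))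
      inj′ (suc i) zero    e = ⊥-elim (punchInᵢ≢i x (lookup ys i) (trans (sym (lookup-punchIn i)) e))
      inj′ (suc i) (suc j) e = cong suc (recompute (i ≟ j) (inj i j
        (punchIn-injective x _ _ (trans (sym (lookup-punchIn i)) (trans e (lookup-punchIn j))))))

    uncons : Arrangement (suc n) → Fin (suc n) × Arrangement n
    uncons (mkArrangement (x ∷ xs) inj) = x , mkArrangement (renumberedTail inj) inj′
      where
      inj′ : ∀ i j → lookup (renumberedTail inj) i ≡ lookup (renumberedTail inj) j → i ≡ j
      inj′ i j e = suc-injective (recompute (suc i ≟ suc j) (inj (suc i) (suc j)
        (punchOut-injective (head-fresh inj i) (head-fresh inj j)
          (trans (sym (lookup∘tabulate _ i)) (trans e (lookup∘tabulate _ j))))))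

    cons∘uncons : ∀ π → cons (uncons π) ≡ π
    cons∘uncons (mkArrangement (x ∷ xs) inj) = arrangement-≡ (cong (x ∷_) (≗-lookup⇒≡ _ xs λ i → begin
      lookup (map (punchIn x) (renumberedTail inj)) i ≡⟨ lookup-map i (punchIn x) (renumberedTail inj) ⟩
      punchIn x (lookup (renumberedTail inj) i)       ≡⟨ cong (punchIn x) (lookup∘tabulate _ i) ⟩
      punchIn x (punchOut (head-fresh inj i))         ≡⟨ punchIn-punchOut (head-fresh inj i) ⟩
      lookup xs i                                     ∎))
      where open ≡-Reasoning

    uncons∘cons : ∀ y → uncons (cons y) ≡ y
    uncons∘cons (x , mkArrangement ys inj) = cong (x ,_) (arrangement-≡ (≗-lookup⇒≡ _ ys λ i →
      trans (lookup∘tabulate _ i) (trans (punchOut-cong x (lookup-map i (punchIn x) ys)) (punchOut-punchIn x))))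

  Arrangement-suc-↔ : (Fin (suc n) × Arrangement n) ↔ Arrangement (suc n)
  Arrangement-suc-↔ = mk↔ₛ′ cons uncons cons∘uncons uncons∘cons

Fin-!-↔ : ∀ n → Fin (n !) ↔ Arrangement n
Fin-!-↔ zero    = mk↔ₛ′ (λ _ → mkArrangement [] (λ ())) (λ _ → zero)
                    (λ { (mkArrangement [] _) → refl }) (λ { zero → refl })
Fin-!-↔ (suc n) = Arrangement-suc-↔ n ↔-∘ Fin-*-↔ ↔-refl (Fin-!-↔ n)

module Cyclic (k : ℕ) where

  private
    N : ℕ
    N = suc k

  mod : ℕ → Fin N
  mod x = fromℕ< (m%n<n x N)

  toℕ-mod : ∀ x → toℕ (mod x) ≡ x % N
  toℕ-mod x = toℕ-fromℕ< _

  mod-toℕ : ∀ a → mod (toℕ a) ≡ a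
  mod-toℕ a = toℕ-injective (trans (toℕ-mod (toℕ a)) (m<n⇒m%n≡m (toℕ<n a)))

  mod-cong : ∀ x y → x % N ≡ y % N → mod x ≡ mod y
  mod-cong x y e = toℕ-injective (trans (toℕ-mod x) (trans e (sym (toℕ-mod y))))

  %-absorbˡ : ∀ a b → (a % N + b) % N ≡ (a + b) % N
  %-absorbˡ a b = begin
    (a % N + b) % N         ≡⟨ %-distribˡ-+ (a % N) b N ⟩
    (a % N % N + b % N) % N ≡⟨ cong (λ z → (z + b % N) % N) (m%n%n≡m%n a N) ⟩
    (a % N + b % N) % N     ≡⟨ %-distribˡ-+ a b N ⟨
    (a + b) % N             ∎
    where open ≡-Reasoning

  %-absorbʳ : ∀ a b → (a + b % N) % N ≡ (a + b) % N
  %-absorbʳ a b = begin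
    (a + b % N) % N ≡⟨ cong (_% N) (+-comm a (b % N)) ⟩
    (b % N + a) % N ≡⟨ %-absorbˡ b a ⟩
    (b + a) % N     ≡⟨ cong (_% N) (+-comm b a) ⟩
    (a + b) % N     ∎
    where open ≡-Reasoning

  mod≡⇒%≡ : ∀ x y → mod x ≡ mod y → x % N ≡ y % N
  mod≡⇒%≡ x y e = trans (sym (toℕ-mod x)) (trans (cong toℕ e) (toℕ-mod y))

  -- Adding N ∸ x % N undoes adding x.
  +-cancelˡ-% : ∀ x {a b} → (x + a) % N ≡ (x + b) % N → a < N → b < N → a ≡ b
  +-cancelˡ-% x {a} {b} e a<N b<N = begin
    a                            ≡⟨ m<n⇒m%n≡m a<N ⟨
    a % N                        ≡⟨ [m+n]%n≡m%n a N ⟨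
    (a + N) % N                  ≡⟨ shift a ⟩
    ((x + a) % N + (N ∸ y)) % N ≡⟨ cong (λ z → (z + (N ∸ y)) % N) e ⟩
    ((x + b) % N + (N ∸ y)) % N ≡⟨ shift b ⟨
    (b + N) % N                  ≡⟨ [m+n]%n≡m%n b N ⟩
    b % N                        ≡⟨ m<n⇒m%n≡m b<N ⟩
    b                            ∎
    where
    open ≡-Reasoning
    y : ℕ
    y = x % N
    shift : ∀ c → (c + N) % N ≡ ((x + c) % N + (N ∸ y)) % N
    shift c = begin
      (c + N) % N                 ≡⟨ cong (λ z → (c + z) % N) (m+[n∸m]≡n (<⇒≤ (m%n<n x N))) ⟨
      (c + (y + (N ∸ y))) % N     ≡⟨ cong (_% N) (+-assoc c y _) ⟨
      (c + y + (N ∸ y)) % N       ≡⟨ %-absorbˡ (c + y) (N ∸ y) ⟨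
      ((c + y) % N + (N ∸ y)) % N ≡⟨ cong (λ z → (z + (N ∸ y)) % N) (%-absorbʳ c x) ⟩
      ((c + x) % N + (N ∸ y)) % N ≡⟨ cong (λ z → (z % N + (N ∸ y)) % N) (+-comm c x) ⟩
      ((x + c) % N + (N ∸ y)) % N ∎

  next : Fin N → Fin N
  next i = mod (suc (toℕ i))

  mod-suc : ∀ r → mod (suc r) ≡ next (mod r)
  mod-suc r = mod-cong (suc r) (suc (toℕ (mod r))) (begin
    suc r % N                  ≡⟨ %-absorbʳ 1 r ⟨
    suc (r % N) % N            ≡⟨ cong (λ z → suc z % N) (toℕ-mod r) ⟨
    suc (toℕ (mod r)) % N      ∎)
    where open ≡-Reasoning

  next-injective : ∀ {i j} → next i ≡ next j → i ≡ j
  next-injective {i} {j} e =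
    toℕ-injective (+-cancelˡ-% 1 (mod≡⇒%≡ (suc (toℕ i)) (suc (toℕ j)) e) (toℕ<n i) (toℕ<n j))

  next-next≢ : 2 ≤ k → ∀ y → next (next y) ≢ y
  next-next≢ 2≤k y e with +-cancelˡ-% (toℕ y) {2} {0} two-steps (s≤s 2≤k) (s≤s z≤n)
    where
    open ≡-Reasoning
    two-steps : (toℕ y + 2) % N ≡ (toℕ y + 0) % N
    two-steps = begin
      (toℕ y + 2) % N               ≡⟨ cong (_% N) (+-comm (toℕ y) 2) ⟩
      suc (suc (toℕ y)) % N         ≡⟨ %-absorbʳ 1 (suc (toℕ y)) ⟨
      suc (suc (toℕ y) % N) % N     ≡⟨ cong (λ z → suc z % N) (toℕ-mod (suc (toℕ y))) ⟨
      suc (toℕ (next y)) % N        ≡⟨ toℕ-mod (suc (toℕ (next y))) ⟨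
      toℕ (next (next y))           ≡⟨ cong toℕ e ⟩
      toℕ y                         ≡⟨ m<n⇒m%n≡m (toℕ<n y) ⟨
      toℕ y % N                     ≡⟨ cong (_% N) (+-identityʳ (toℕ y)) ⟨
      (toℕ y + 0) % N               ∎
  ... | ()

  toℕ-next-< : ∀ i → toℕ i < k → toℕ (next i) ≡ suc (toℕ i)
  toℕ-next-< i i<k = trans (toℕ-mod (suc (toℕ i))) (m<n⇒m%n≡m (s≤s i<k))

  toℕ-next-last : ∀ i → toℕ i ≡ k → toℕ (next i) ≡ 0
  toℕ-next-last i e = trans (toℕ-mod (suc (toℕ i))) (trans (cong (λ z → suc z % N) e) (n%n≡0 N))

  CyclicSuccessor : Fin N → Fin N → Set
  CyclicSuccessor i j = toℕ j ≡ suc (toℕ i) ⊎ (toℕ i ≡ k × toℕ j ≡ 0)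

  cyclicSuccessor⇒next : ∀ i j → CyclicSuccessor i j → j ≡ next i
  cyclicSuccessor⇒next i j (inj₁ e) =
    toℕ-injective (trans e (sym (toℕ-next-< i (≤-trans (≤-reflexive (sym e)) (≤-pred (toℕ<n j))))))
  cyclicSuccessor⇒next i j (inj₂ (i≡k , j≡0)) = toℕ-injective (trans j≡0 (sym (toℕ-next-last i i≡k)))

  next⇒cyclicSuccessor : ∀ i → CyclicSuccessor i (next i)
  next⇒cyclicSuccessor i with toℕ i <? k
  ... | yes i<k = inj₁ (toℕ-next-< i i<k)
  ... | no  i≮k = inj₂ (i≡k , toℕ-next-last i i≡k)
    where
    i≡k : toℕ i ≡ k
    i≡k = ≤-antisym (≤-pred (toℕ<n i)) (≮⇒≥ i≮k)

  next-opposite-next : ∀ i → next (opposite (next i)) ≡ opposite i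
  next-opposite-next i = toℕ-injective (by-position (next⇒cyclicSuccessor i))
    where
    open ≡-Reasoning
    by-position : CyclicSuccessor i (next i) → toℕ (next (opposite (next i))) ≡ toℕ (opposite i)
    by-position (inj₁ e) = begin
      toℕ (next (opposite (next i))) ≡⟨ toℕ-mod (suc (toℕ (opposite (next i)))) ⟩
      suc (toℕ (opposite (next i))) % N ≡⟨ cong (λ z → suc z % N) (opposite-prop (next i)) ⟩
      suc (k ∸ toℕ (next i)) % N     ≡⟨ cong (λ z → suc (k ∸ z) % N) e ⟩
      suc (k ∸ suc (toℕ i)) % N      ≡⟨ cong (_% N) (+-∸-assoc 1 i<k) ⟨
      (k ∸ toℕ i) % N                ≡⟨ m<n⇒m%n≡m (s≤s (m∸n≤m k (toℕ i))) ⟩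
      k ∸ toℕ i                      ≡⟨ opposite-prop i ⟨
      toℕ (opposite i)               ∎
      where
      i<k : toℕ i < k
      i<k = ≤-trans (≤-reflexive (sym e)) (≤-pred (toℕ<n (next i)))
    by-position (inj₂ (i≡k , next≡0)) = begin
      toℕ (next (opposite (next i))) ≡⟨ toℕ-next-last _ (trans (opposite-prop (next i)) (cong (k ∸_) next≡0)) ⟩
      0                              ≡⟨ n∸n≡0 k ⟨
      k ∸ k                          ≡⟨ cong (k ∸_) i≡k ⟨
      k ∸ toℕ i                      ≡⟨ opposite-prop i ⟨
      toℕ (opposite i)               ∎

  infixl 6 _⊕_
  _⊕_ : Fin N → Fin N → Fin N
  j ⊕ t = mod (toℕ j + toℕ t)

  ⊕-identityʳ : ∀ j → j ⊕ zero ≡ j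
  ⊕-identityʳ j = trans (cong mod (+-identityʳ (toℕ j))) (mod-toℕ j)

  ⊕-identityʳ-injective : ∀ {j j′} → j ⊕ zero ≡ j′ ⊕ zero → j ≡ j′
  ⊕-identityʳ-injective {j} {j′} e = trans (sym (⊕-identityʳ j)) (trans e (⊕-identityʳ j′))

  ⊕-next : ∀ j t → j ⊕ next t ≡ next (j ⊕ t)
  ⊕-next j t = mod-cong (toℕ j + toℕ (next t)) (suc (toℕ (j ⊕ t))) (begin
    (toℕ j + toℕ (next t)) % N    ≡⟨ cong (λ z → (toℕ j + z) % N) (toℕ-mod (suc (toℕ t))) ⟩
    (toℕ j + suc (toℕ t) % N) % N ≡⟨ %-absorbʳ (toℕ j) (suc (toℕ t)) ⟩
    (toℕ j + suc (toℕ t)) % N     ≡⟨ cong (_% N) (+-suc (toℕ j) (toℕ t)) ⟩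
    suc (toℕ j + toℕ t) % N       ≡⟨ %-absorbʳ 1 (toℕ j + toℕ t) ⟨
    suc ((toℕ j + toℕ t) % N) % N ≡⟨ cong (λ z → suc z % N) (toℕ-mod (toℕ j + toℕ t)) ⟨
    suc (toℕ (j ⊕ t)) % N         ∎)
    where open ≡-Reasoning

  ⊕-next-zero : ∀ j → j ⊕ next zero ≡ next j
  ⊕-next-zero j = trans (⊕-next j zero) (cong next (⊕-identityʳ j))

  ⊕-cancelˡ : ∀ j t t′ → j ⊕ t ≡ j ⊕ t′ → t ≡ t′
  ⊕-cancelˡ j t t′ e =
    toℕ-injective (+-cancelˡ-% (toℕ j) (mod≡⇒%≡ (toℕ j + toℕ t) (toℕ j + toℕ t′) e) (toℕ<n t) (toℕ<n t′))

module CyclicSequence (k : ℕ) {X : Set} where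

  open Cyclic k

  private
    N : ℕ
    N = suc k

  Seq : Set
  Seq = Fin N → X

  Injective : Seq → Set
  Injective c = ∀ i j → c i ≡ c j → i ≡ j

  CyclicallyRelated : (X → X → Set) → Seq → Set
  CyclicallyRelated R c = ∀ i → R (c i) (c (next i))

  Joins : X → X → X → X → Set
  Joins u v a b = (a ≡ u × b ≡ v) ⊎ (a ≡ v × b ≡ u)

  Joins-swap : ∀ {u v a b} → Joins u v a b → Joins u v b a
  Joins-swap (inj₁ (a≡u , b≡v)) = inj₂ (b≡v , a≡u)
  Joins-swap (inj₂ (a≡v , b≡u)) = inj₁ (b≡u , a≡v)

  Joins-cong : ∀ {u v a a′ b b′} → a ≡ a′ → b ≡ b′ → Joins u v a b → Joins u v a′ b′
  Joins-cong refl refl j = j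

  Edge : Seq → X → X → Set
  Edge c u v = ∃ λ i → Joins u v (c i) (c (next i))

  Edge-cong : ∀ {c c′} → (∀ i → c i ≡ c′ i) → ∀ {u v} → Edge c u v → Edge c′ u v
  Edge-cong c≗c′ (i , e) = i , Joins-cong (c≗c′ i) (c≗c′ (next i)) e

  rotate : Fin N → Seq → Seq
  rotate j c t = c (j ⊕ t)

  reflect : Seq → Seq
  reflect c t = c (opposite t)

  -- the dihedral group of order 2N acting on positions; b = 1 reflects first
  dihedral : Fin 2 → Fin N → Seq → Seq
  dihedral zero       j c = rotate j c
  dihedral (suc zero) j c = rotate j (reflect c)

  Edge-rotate⁺ : ∀ j c {u v} → Edge c u v → Edge (rotate j c) u v
  Edge-rotate⁺ j c (i , e) with injective⇒surjective ↔-refl (j ⊕_) (⊕-cancelˡ j) i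
  ... | t , refl = t , Joins-cong refl (cong c (sym (⊕-next j t))) e

  Edge-rotate⁻ : ∀ j c {u v} → Edge (rotate j c) u v → Edge c u v
  Edge-rotate⁻ j c (t , e) = j ⊕ t , Joins-cong refl (cong c (⊕-next j t)) e

  opposite-next-opposite-next : ∀ i → opposite (next (opposite (next i))) ≡ i
  opposite-next-opposite-next i =
    next-injective (trans (next-opposite-next (opposite (next i))) (opposite-involutive (next i)))

  Edge-reflect⁺ : ∀ c {u v} → Edge c u v → Edge (reflect c) u v
  Edge-reflect⁺ c (i , e) = opposite (next i) ,
    Joins-cong (cong c (sym (opposite-involutive (next i))))
               (cong c (sym (opposite-next-opposite-next i))) (Joins-swap e)

  Edge-reflect⁻ : ∀ c {u v} → Edge (reflect c) u v → Edge c u v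
  Edge-reflect⁻ c (t , e) = opposite (next t) ,
    Joins-cong refl (cong c (sym (next-opposite-next t))) (Joins-swap e)

  Edge-dihedral⁺ : ∀ b j c {u v} → Edge c u v → Edge (dihedral b j c) u v
  Edge-dihedral⁺ zero       j c e = Edge-rotate⁺ j c e
  Edge-dihedral⁺ (suc zero) j c e = Edge-rotate⁺ j (reflect c) (Edge-reflect⁺ c e)

  Edge-dihedral⁻ : ∀ b j c {u v} → Edge (dihedral b j c) u v → Edge c u v
  Edge-dihedral⁻ zero       j c e = Edge-rotate⁻ j c e
  Edge-dihedral⁻ (suc zero) j c e = Edge-reflect⁻ c (Edge-rotate⁻ j (reflect c) e)

  opposite-injective : ∀ {a b : Fin N} → opposite a ≡ opposite b → a ≡ b
  opposite-injective {a} {b} e =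
    trans (sym (opposite-involutive a)) (trans (cong opposite e) (opposite-involutive b))

  Injective-rotate : ∀ j c → Injective c → Injective (rotate j c)
  Injective-rotate j c inj t t′ e = ⊕-cancelˡ j t t′ (inj _ _ e)

  Injective-reflect : ∀ c → Injective c → Injective (reflect c)
  Injective-reflect c inj t t′ e = opposite-injective (inj _ _ e)

  Injective-dihedral : ∀ b j c → Injective c → Injective (dihedral b j c)
  Injective-dihedral zero       j c inj = Injective-rotate j c inj
  Injective-dihedral (suc zero) j c inj = Injective-rotate j (reflect c) (Injective-reflect c inj)

  CyclicallyRelated-dihedral : ∀ {R} → (∀ {x y} → R x y → R y x) →
                               ∀ b j c → CyclicallyRelated R c → CyclicallyRelated R (dihedral b j c)
  CyclicallyRelated-dihedral {R} R-sym zero j c r t =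
    subst (λ z → R (c (j ⊕ t)) (c z)) (sym (⊕-next j t)) (r (j ⊕ t))
  CyclicallyRelated-dihedral {R} R-sym (suc zero) j c r t =
    subst (λ z → R (c (opposite (j ⊕ t))) (c (opposite z))) (sym (⊕-next j t)) (R-sym
      (subst (λ z → R (c (opposite (next s))) (c z)) (next-opposite-next s) (r (opposite (next s)))))
    where
    s : Fin N
    s = j ⊕ t

  module _ (2≤k : 2 ≤ k) where

    -- An injective walk along edges of the cycle c cannot turn back, since that would
    -- revisit a vertex; hence once its first step agrees with c it runs around c.
    walk-along-cycle : ∀ {p c} → Injective p → Injective c → (∀ {u v} → Edge p u v → Edge c u v) →
                       ∀ j → p zero ≡ c j → p (next zero) ≡ c (next j) → ∀ t → p t ≡ rotate j c t
    walk-along-cycle {p} {c} p-inj c-inj p⊆c j start₀ start₁ t =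
      subst (λ z → p z ≡ c (j ⊕ z)) (mod-toℕ t) (proj₁ (agree (toℕ t)))
      where
      Agrees : ℕ → Set
      Agrees r = p (mod r) ≡ c (j ⊕ mod r)

      j⊕mod-suc : ∀ r → j ⊕ mod (suc r) ≡ next (j ⊕ mod r)
      j⊕mod-suc r = trans (cong (j ⊕_) (mod-suc r)) (⊕-next j (mod r))

      step : ∀ r → Agrees r → Agrees (suc r) → Agrees (suc (suc r))
      step r agree₀ agree₁ with p⊆c (mod (suc r) , inj₁ (refl , cong p (sym (mod-suc (suc r)))))
      ... | i , inj₁ (ci≡p₁ , cnexti≡p₂) = begin
        p (mod (suc (suc r)))     ≡⟨ cnexti≡p₂ ⟨
        c (next i)                ≡⟨ cong (c ∘ next) (c-inj _ _ (trans ci≡p₁ agree₁)) ⟩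
        c (next (j ⊕ mod (suc r))) ≡⟨ cong c (j⊕mod-suc (suc r)) ⟨
        c (j ⊕ mod (suc (suc r))) ∎
        where open ≡-Reasoning
      ... | i , inj₂ (ci≡p₂ , cnexti≡p₁) = ⊥-elim (next-next≢ 2≤k (mod r) (begin
        next (next (mod r)) ≡⟨ trans (mod-suc (suc r)) (cong next (mod-suc r)) ⟨
        mod (suc (suc r))   ≡⟨ p-inj _ _ (trans (sym ci≡p₂) (trans (cong c i≡) (sym agree₀))) ⟩
        mod r               ∎))
        where
        open ≡-Reasoning
        i≡ : i ≡ j ⊕ mod r
        i≡ = next-injective (c-inj _ _ (trans cnexti≡p₁ (trans agree₁ (cong c (j⊕mod-suc r)))))

      agree : ∀ r → Agrees r × Agrees (suc r)
      agree zero    = trans start₀ (cong c (sym (⊕-identityʳ j))) ,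
                      trans (cong p (mod-suc 0)) (trans start₁ (cong c (sym j⊕mod-1)))
        where
        j⊕mod-1 : j ⊕ mod 1 ≡ next j
        j⊕mod-1 = trans (j⊕mod-suc 0) (cong next (⊕-identityʳ j))
      agree (suc r) = proj₂ (agree r) , step r (proj₁ (agree r)) (proj₂ (agree r))

    cycle-rigidity : ∀ {p c} → Injective p → Injective c → (∀ {u v} → Edge p u v → Edge c u v) →
                     ∃ λ b → ∃ λ j → ∀ t → p t ≡ dihedral b j c t
    cycle-rigidity {p} {c} p-inj c-inj p⊆c with p⊆c (zero , inj₁ (refl , refl))
    ... | i , inj₁ (ci≡p₀ , cnexti≡p₁) = zero , i , walk-along-cycle p-inj c-inj p⊆c i (sym ci≡p₀) (sym cnexti≡p₁)
    ... | i , inj₂ (ci≡p₁ , cnexti≡p₀) = suc zero , opposite (next i) ,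
      walk-along-cycle p-inj (Injective-reflect c c-inj) (λ e → Edge-reflect⁺ c (p⊆c e)) (opposite (next i))
        (trans (sym cnexti≡p₀) (cong c (sym (opposite-involutive (next i)))))
        (trans (sym ci≡p₁) (cong c (sym (opposite-next-opposite-next i))))

    -- Comparing positions 0 and 1 forces j = opposite j′ and next j = opposite (next j′),
    -- whence next (next j) = j.
    rotate≢rotate-reflect : ∀ {c} → Injective c → ∀ j j′ → ¬ (∀ t → rotate j c t ≡ rotate j′ (reflect c) t)
    rotate≢rotate-reflect {c} c-inj j j′ same = next-next≢ 2≤k j (begin
      next (next j)                  ≡⟨ cong next at₁ ⟩
      next (opposite (next j′))      ≡⟨ next-opposite-next j′ ⟩
      opposite j′                    ≡⟨ at₀ ⟨
      j                              ∎)
      where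
      open ≡-Reasoning
      at₀ : j ≡ opposite j′
      at₀ = c-inj _ _ (trans (cong c (sym (⊕-identityʳ j)))
                        (trans (same zero) (cong (c ∘ opposite) (⊕-identityʳ j′))))
      at₁ : next j ≡ opposite (next j′)
      at₁ = c-inj _ _ (trans (cong c (sym (⊕-next-zero j)))
                        (trans (same (next zero)) (cong (c ∘ opposite) (⊕-next-zero j′))))

    dihedral-free : ∀ {c} → Injective c → ∀ b j b′ j′ →
                    (∀ t → dihedral b j c t ≡ dihedral b′ j′ c t) → (b , j) ≡ (b′ , j′)
    dihedral-free {c} c-inj zero       j zero       j′ same =
      cong (zero ,_) (⊕-identityʳ-injective (c-inj _ _ (same zero)))
    dihedral-free {c} c-inj (suc zero) j (suc zero) j′ same =
      cong (suc zero ,_) (⊕-identityʳ-injective (opposite-injective (c-inj _ _ (same zero))))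
    dihedral-free {c} c-inj zero       j (suc zero) j′ same = ⊥-elim (rotate≢rotate-reflect c-inj j j′ same)
    dihedral-free {c} c-inj (suc zero) j zero       j′ same =
      ⊥-elim (rotate≢rotate-reflect c-inj j′ j (λ t → sym (same t)))

module _ {A : Set} (_≟A_ : DecidableEquality A) where

  countBefore : ∀ {L} → Vec A L → A → Fin L → ℕ
  countBefore (x ∷ xs) a zero    = 0
  countBefore (x ∷ xs) a (suc t) with x ≟A a
  ... | yes _ = suc (countBefore xs a t)
  ... | no  _ = countBefore xs a t

  countBefore<count : ∀ {L} (xs : Vec A L) t → countBefore xs (lookup xs t) t < count (_≟A lookup xs t) xs
  countBefore<count (x ∷ xs) zero    with x ≟A x
  ... | yes _   = s≤s z≤n
  ... | no  x≢x = ⊥-elim (x≢x refl)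
  countBefore<count (x ∷ xs) (suc t) with x ≟A lookup xs t
  ... | yes _ = s≤s (countBefore<count xs t)
  ... | no  _ = countBefore<count xs t

  countBefore-strictMono : ∀ {L} (xs : Vec A L) s t → toℕ s < toℕ t →
                           countBefore xs (lookup xs s) s < countBefore xs (lookup xs s) t
  countBefore-strictMono (x ∷ xs) zero    (suc t) _ with x ≟A x
  ... | yes _   = s≤s z≤n
  ... | no  x≢x = ⊥-elim (x≢x refl)
  countBefore-strictMono (x ∷ xs) (suc s) (suc t) (s≤s s<t) with x ≟A lookup xs s
  ... | yes _ = s≤s (countBefore-strictMono xs s t s<t)
  ... | no  _ = countBefore-strictMono xs s t s<t

module Colouring (m n : ℕ) where

  private
    L : ℕ
    L = m * n

  HasColourCounts : Vec (Fin m) L → Set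
  HasColourCounts col = ∀ a → count (_≟ a) col ≡ n

  module _ (col : Vec (Fin m) L) .(counts : HasColourCounts col) where

    -- position t holds the (rank t)-th occurrence of its colour
    rank : Fin L → Fin n
    rank t = fromℕ< (subst (countBefore _≟_ col (lookup col t) t <_) (counts (lookup col t))
                           (countBefore<count _≟_ col t))

    occurrence : Fin L → Fin m × Fin n
    occurrence t = lookup col t , rank t

    private
      rank-≡ : ∀ s t → occurrence s ≡ occurrence t →
               countBefore _≟_ col (lookup col s) s ≡ countBefore _≟_ col (lookup col s) t
      rank-≡ s t e = trans (sym (toℕ-fromℕ< _)) (trans (cong (toℕ ∘ proj₂) e)
        (trans (toℕ-fromℕ< _) (cong (λ a → countBefore _≟_ col a t) (sym (cong proj₁ e)))))

    -- earlier occurrences of a colour have smaller ranks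
    occurrence-injective : ∀ s t → occurrence s ≡ occurrence t → s ≡ t
    occurrence-injective s t e with <-cmp s t
    ... | tri≈ _ s≡t _ = s≡t
    ... | tri< s<t _ _ = ⊥-elim (<-irrefl (rank-≡ s t e) (countBefore-strictMono _≟_ col s t s<t))
    ... | tri> _ _ t<s = ⊥-elim (<-irrefl (rank-≡ t s (sym e)) (countBefore-strictMono _≟_ col t s t<s))

    positionOf : Fin m × Fin n → Fin L
    positionOf y = proj₁ (injective⇒surjective *↔× occurrence occurrence-injective y)

    occurrence∘positionOf : ∀ y → occurrence (positionOf y) ≡ y
    occurrence∘positionOf y = proj₂ (injective⇒surjective *↔× occurrence occurrence-injective y)

    positionOf∘occurrence : ∀ t → positionOf (occurrence t) ≡ t
    positionOf∘occurrence t = occurrence-injective _ _ (occurrence∘positionOf (occurrence t))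

  positionOf-cong : ∀ {col col′} → col ≡ col′ → .(counts : HasColourCounts col) .(counts′ : HasColourCounts col′) →
                    ∀ y → positionOf col counts y ≡ positionOf col′ counts′ y
  positionOf-cong refl _ _ _ = refl

  classCount : (ls : Vec (Letter m n) L) → EachOnce ls → HasColourCounts (map class ls)
  classCount ls (inj , onto) a = sym (↔-card classMembers (Fin-count-↔ (_≟ a) ≡-irrelevant (map class ls)))
    where
    ≡-irrelevant : ∀ {k} {i j : Fin k} (p q : i ≡ j) → p ≡ q
    ≡-irrelevant = UIP.Decidable⇒UIP.≡-irrelevant _≟_
    position : Fin n → Fin L
    position r = proj₁ (onto (a , r))
    classMembers : Fin n ↔ Σ (Fin L) (λ i → lookup (map class ls) i ≡ a)
    classMembers = mk↔ₛ′
      (λ r → position r , trans (lookup-map (position r) class ls) (cong class (proj₂ (onto (a , r)))))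
      (λ (i , _) → proj₂ (lookup ls i))
      (λ (i , cls≡a) → Σ-≡ (inj _ _ (trans (proj₂ (onto (a , proj₂ (lookup ls i))))
                              (cong (_, proj₂ (lookup ls i)) (trans (sym cls≡a) (lookup-map i class ls))))))
      (λ r → cong proj₂ (proj₂ (onto (a , r))))
      where
      Σ-≡ : ∀ {i i′} {p : lookup (map class ls) i ≡ a} {p′} → i ≡ i′ → (i , p) ≡ (i′ , p′)
      Σ-≡ refl = cong (_ ,_) (≡-irrelevant _ _)

  permuteWithin : Vec (Arrangement n) m → Letter m n → Letter m n
  permuteWithin πs (a , r) = a , lookup (Arrangement.vec (lookup πs a)) r

  permuteWithin-injective : ∀ πs x y → permuteWithin πs x ≡ permuteWithin πs y → x ≡ y
  permuteWithin-injective πs (a , r) (b , r′) e with cong proj₁ e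
  ... | refl = cong (a ,_) (arrangement-injective (lookup πs a) r r′ (cong proj₂ e))

  module _ (col : Vec (Fin m) L) .(counts : HasColourCounts col) (πs : Vec (Arrangement n) m) where

    assemble : Vec (Letter m n) L
    assemble = tabulate (permuteWithin πs ∘ occurrence col counts)

    class-assemble : ∀ t → class (lookup assemble t) ≡ lookup col t
    class-assemble t = cong proj₁ (lookup∘tabulate (permuteWithin πs ∘ occurrence col counts) t)

    assemble-injective : ∀ s t → lookup assemble s ≡ lookup assemble t → s ≡ t
    assemble-injective s t e = occurrence-injective col counts s t (permuteWithin-injective πs _ _
      (trans (sym (lookup∘tabulate _ s)) (trans e (lookup∘tabulate _ t))))

    assemble-eachOnce : EachOnce assemble
    assemble-eachOnce = assemble-injective , injective⇒surjective *↔× (lookup assemble) assemble-injective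

  fromColouring : ColourWord m n × Vec (Arrangement n) m → Word m n
  fromColouring (mkColourWord col counts consec firstLast , πs) =
    mkWord (assemble col counts πs) (assemble-eachOnce col counts πs)
      (λ i j i→j → consec i j i→j ∘ class≡) (λ i j i≡0 j≡k → firstLast i j i≡0 j≡k ∘ class≡)
    where
    class≡ : ∀ {i j} → class (lookup (assemble col counts πs) i) ≡ class (lookup (assemble col counts πs) j) →
             lookup col i ≡ lookup col j
    class≡ {i} {j} e = trans (sym (class-assemble col counts πs i)) (trans e (class-assemble col counts πs j))

  -- the arrangement of colour a records, rank by rank, which letter of 𝒜_a occurs
  arrangementOf : (ls : Vec (Letter m n) L) → .(EachOnce ls) → Fin m → Arrangement n
  arrangementOf ls eachOnce a = mkArrangement (tabulate letterAt) inj
    where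
    col : Vec (Fin m) L
    col = map class ls
    occ : Fin L → Fin m × Fin n
    occ = occurrence col (classCount ls eachOnce)
    at : Fin n → Fin L
    at r = positionOf col (classCount ls eachOnce) (a , r)
    occ∘at : ∀ r → occ (at r) ≡ (a , r)
    occ∘at r = occurrence∘positionOf col (classCount ls eachOnce) (a , r)
    letterAt : Fin n → Fin n
    letterAt r = proj₂ (lookup ls (at r))
    class-at : ∀ r → class (lookup ls (at r)) ≡ a
    class-at r = trans (sym (lookup-map (at r) class ls)) (cong proj₁ (occ∘at r))
    inj : ∀ r r′ → lookup (tabulate letterAt) r ≡ lookup (tabulate letterAt) r′ → r ≡ r′
    inj r r′ e = recompute (r ≟ r′) (cong proj₂ (begin
      (a , r)       ≡⟨ occ∘at r ⟨
      occ (at r)    ≡⟨ cong occ (proj₁ eachOnce (at r) (at r′) same-letter) ⟩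
      occ (at r′)   ≡⟨ occ∘at r′ ⟩
      (a , r′)      ∎))
      where
      open ≡-Reasoning
      same-letter : lookup ls (at r) ≡ lookup ls (at r′)
      same-letter = cong₂ _,_ (trans (class-at r) (sym (class-at r′)))
                              (trans (sym (lookup∘tabulate letterAt r)) (trans e (lookup∘tabulate letterAt r′)))

  toColouring : Word m n → ColourWord m n × Vec (Arrangement n) m
  toColouring (mkWord ls eachOnce consec firstLast) =
    mkColourWord (map class ls) (classCount ls eachOnce)
      (λ i j i→j → consec i j i→j ∘ class≡) (λ i j i≡0 j≡k → firstLast i j i≡0 j≡k ∘ class≡) ,
    tabulate (arrangementOf ls eachOnce)
    where
    class≡ : ∀ {i j} → lookup (map class ls) i ≡ lookup (map class ls) j → class (lookup ls i) ≡ class (lookup ls j)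
    class≡ {i} {j} e = trans (sym (lookup-map i class ls)) (trans e (lookup-map j class ls))

  word-≡ : ∀ {u v : Vec (Letter m n) L} .{u₁ u₂ u₃ v₁ v₂ v₃} → u ≡ v →
           mkWord u u₁ u₂ u₃ ≡ mkWord v v₁ v₂ v₃
  word-≡ refl = refl

  colourWord-≡ : ∀ {u v : Vec (Fin m) L} .{u₁ u₂ u₃ v₁ v₂ v₃} → u ≡ v →
                 mkColourWord u u₁ u₂ u₃ ≡ mkColourWord v v₁ v₂ v₃
  colourWord-≡ refl = refl

  fromColouring∘toColouring : ∀ w → fromColouring (toColouring w) ≡ w
  fromColouring∘toColouring (mkWord ls eachOnce _ _) = word-≡ (≗-lookup⇒≡ _ ls λ t → begin
    lookup (tabulate (permuteWithin πs ∘ occ)) t   ≡⟨ lookup∘tabulate (permuteWithin πs ∘ occ) t ⟩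
    lookup col t , lookup (vecOf (lookup πs (lookup col t))) (rk t)
      ≡⟨ cong (λ π → lookup col t , lookup (vecOf π) (rk t)) (lookup∘tabulate (arrangementOf ls eachOnce) _) ⟩
    lookup col t , lookup (vecOf (arrangementOf ls eachOnce (lookup col t))) (rk t)
      ≡⟨ cong (lookup col t ,_) (lookup∘tabulate (λ r → proj₂ (lookup ls (pos (lookup col t , r)))) (rk t)) ⟩
    lookup col t , proj₂ (lookup ls (pos (occ t)))
      ≡⟨ cong (λ s → lookup col t , proj₂ (lookup ls s)) (positionOf∘occurrence col (classCount ls eachOnce) t) ⟩
    lookup col t , proj₂ (lookup ls t)             ≡⟨ cong (_, proj₂ (lookup ls t)) (lookup-map t class ls) ⟩
    lookup ls t                                    ∎)
    where
    open ≡-Reasoning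
    vecOf : Arrangement n → Vec (Fin n) n
    vecOf = Arrangement.vec
    col : Vec (Fin m) L
    col = map class ls
    πs : Vec (Arrangement n) m
    πs = tabulate (arrangementOf ls eachOnce)
    occ : Fin L → Fin m × Fin n
    occ = occurrence col (classCount ls eachOnce)
    rk : Fin L → Fin n
    rk = rank col (classCount ls eachOnce)
    pos : Fin m × Fin n → Fin L
    pos = positionOf col (classCount ls eachOnce)

  toColouring∘fromColouring : ∀ x → toColouring (fromColouring x) ≡ x
  toColouring∘fromColouring (mkColourWord col counts _ _ , πs) =
    cong₂ _,_ (colourWord-≡ col′≡col) (≗-lookup⇒≡ _ πs λ a →
      trans (lookup∘tabulate (arrangementOf w eachOnce) a) (arrangement-≡ (≗-lookup⇒≡ _ _ λ r → begin
        lookup (Arrangement.vec (arrangementOf w eachOnce a)) r  ≡⟨ lookup∘tabulate _ r ⟩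
        proj₂ (lookup w (positionOf col′ (classCount w eachOnce) (a , r)))
          ≡⟨ cong (proj₂ ∘ lookup w) (positionOf-cong col′≡col (classCount w eachOnce) counts (a , r)) ⟩
        proj₂ (lookup w (positionOf col counts (a , r)))
          ≡⟨ cong proj₂ (lookup∘tabulate (permuteWithin πs ∘ occurrence col counts) _) ⟩
        proj₂ (permuteWithin πs (occurrence col counts (positionOf col counts (a , r))))
          ≡⟨ cong (proj₂ ∘ permuteWithin πs) (occurrence∘positionOf col counts (a , r)) ⟩
        lookup (Arrangement.vec (lookup πs a)) r                 ∎)))
    where
    open ≡-Reasoning
    w : Vec (Letter m n) L
    w = assemble col counts πs
    eachOnce : EachOnce w
    eachOnce = assemble-eachOnce col counts πs
    col′ : Vec (Fin m) L
    col′ = map class w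
    col′≡col : col′ ≡ col
    col′≡col = ≗-lookup⇒≡ col′ col λ t → trans (lookup-map t class w) (class-assemble col counts πs t)

  Word↔Colouring : Word m n ↔ (ColourWord m n × Vec (Arrangement n) m)
  Word↔Colouring = mk↔ₛ′ toColouring fromColouring toColouring∘fromColouring fromColouring∘toColouring

does⇒ : ∀ {A : Set} (a? : Dec A) → does a? ≡ true → A
does⇒ (yes a) _ = a
does⇒ (no _) ()

does≡true⇔ : ∀ {A : Set} (a? : Dec A) → (does a? ≡ true) ⇔ A
does≡true⇔ a? = mk⇔ (does⇒ a?) (dec-true a?)

bool-≡-does : ∀ {A : Set} b (a? : Dec A) → (b ≡ true) ⇔ A → b ≡ does a?
bool-≡-does true  a? b⇔a = sym (dec-true a? (Equivalence.to b⇔a refl))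
bool-≡-does false a? b⇔a = sym (dec-false a? (λ a → false≢true (Equivalence.from b⇔a a)))
  where
  false≢true : false ≢ true
  false≢true ()

distinct⇒2≤ : ∀ {m} (a b : Fin m) → a ≢ b → 2 ≤ m
distinct⇒2≤ {suc zero}    zero zero a≢b = ⊥-elim (a≢b refl)
distinct⇒2≤ {suc (suc _)} _    _    _   = s≤s (s≤s z≤n)

3≤* : ∀ {m n} → 2 ≤ m → 1 ≤ n → ¬ (m ≡ 2 × n ≡ 1) → 3 ≤ m * n
3≤* {1}                 (s≤s ()) _   _
3≤* {2} {1}             _        _   m,n≢2,1 = ⊥-elim (m,n≢2,1 (refl , refl))
3≤* {2} {suc (suc n)}   _        _   _       =
  ≤-trans (s≤s (s≤s (s≤s z≤n))) (*-mono-≤ {2} ≤-refl (s≤s (s≤s (z≤n {n}))))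
3≤* {suc (suc (suc m))} _        1≤n _       = *-mono-≤ {3} (s≤s (s≤s (s≤s (z≤n {m})))) 1≤n

Fiber-≡ : ∀ {m n} {f : DPath m n → HamCycle m n} {C} {x y : Fiber f C} →
          DPath.path (Fiber.point x) ≡ DPath.path (Fiber.point y) → x ≡ y
Fiber-≡ {x = mkFiber (mkDPath p _ _) _} {mkFiber (mkDPath .p _ _) _} refl = refl

module Hamiltonian (m′ n′ : ℕ) where

  m n k : ℕ
  m = suc m′
  n = suc n′
  -- chosen so that suc k and m * n are definitionally equal
  k = n′ + m′ * suc n′

  V : Set
  V = Vertex m n

  open Cyclic k
  open CyclicSequence k {V}

  _≟V_ : DecidableEquality V
  _≟V_ = Product.≡-dec _≟_ _≟_

  vertices : Fin (m * n) ↔ V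
  vertices = *↔×

  IsHamCycle : Seq → Set
  IsHamCycle s = Injective s × CyclicallyRelated Adj s

  IsHamCycle-cong : ∀ {s s′} → (∀ i → s i ≡ s′ i) → IsHamCycle s → IsHamCycle s′
  IsHamCycle-cong {s} {s′} s≗s′ (inj , adj) =
    (λ i j e → inj i j (trans (s≗s′ i) (trans e (sym (s≗s′ j))))) ,
    (λ i → subst₂ Adj (s≗s′ i) (s≗s′ (next i)) (adj i))

  IsHamCycle? : ∀ s → Dec (IsHamCycle s)
  IsHamCycle? s = (all? λ i → all? λ j → (s i ≟V s j) →-dec (i ≟ j)) ×-dec
                  (all? λ i → ¬? (part (s i) ≟ part (s (next i))))

  Edge? : ∀ c u v → Dec (Edge c u v)
  Edge? c u v = any? λ i → ((c i ≟V u) ×-dec (c (next i) ≟V v)) ⊎-dec ((c i ≟V v) ×-dec (c (next i) ≟V u))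

  edgeSet : Seq → V → V → Bool
  edgeSet c u v = does (Edge? c u v)

  edgeSet-cong : ∀ c c′ → (∀ {u v} → Edge c u v → Edge c′ u v) → (∀ {u v} → Edge c′ u v → Edge c u v) →
                 ∀ u v → edgeSet c u v ≡ edgeSet c′ u v
  edgeSet-cong c c′ c⊆c′ c′⊆c u v = does-⇔ (mk⇔ c⊆c′ c′⊆c) (Edge? c u v) (Edge? c′ u v)

  CycleEdge⇔Edge : ∀ (c : Vec V (m * n)) u v → CycleEdge m n c u v ⇔ Edge (lookup c) u v
  CycleEdge⇔Edge c u v = mk⇔ to′ (λ (i , e) → i , next i , next⇒cyclicSuccessor i , e)
    where
    to′ : CycleEdge m n c u v → Edge (lookup c) u v
    to′ (i , j , i→j , e) with cyclicSuccessor⇒next i j i→j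
    ... | refl = i , e

  module _ (c : Vec V (m * n)) where

    last : Fin (m * n)
    last = fromℕ k

    cyclicallyAdjacent : ConsecutiveRel Adj c → FirstLastRel (λ u v → Adj v u) c →
                         CyclicallyRelated Adj (lookup c)
    cyclicallyAdjacent consec wrap i with next⇒cyclicSuccessor i
    ... | inj₁ i→j           = consec i (next i) i→j
    ... | inj₂ (i≡k , j≡0)   = wrap (next i) i j≡0 i≡k

    hamCycle⇒path : IsHamCycle (lookup c) → IsDirHamPath m n c × FirstLastRel DiffPart c
    hamCycle⇒path (inj , adj) =
      ((inj , injective⇒surjective vertices (lookup c) inj) ,
       (λ i j i→j → subst (Adj (lookup c i) ∘ lookup c) (sym (cyclicSuccessor⇒next i j (inj₁ i→j))) (adj i))) ,
      (λ i j i≡0 j≡k → ≢-sym (subst (Adj (lookup c j) ∘ lookup c)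
                                    (sym (cyclicSuccessor⇒next j i (inj₂ (j≡k , i≡0)))) (adj j)))

    path⇒hamCycle : IsDirHamPath m n c → FirstLastRel DiffPart c → IsHamCycle (lookup c)
    path⇒hamCycle ((inj , _) , consec) ends =
      inj , cyclicallyAdjacent consec (λ i j i≡0 j≡k → ≢-sym (ends i j i≡0 j≡k))

    path⇒3≤mn : ¬ (m ≡ 2 × n ≡ 1) → FirstLastRel DiffPart c → 3 ≤ m * n
    path⇒3≤mn m,n≢2,1 ends = 3≤* (distinct⇒2≤ _ _ (ends zero last refl (toℕ-fromℕ k))) (s≤s z≤n) m,n≢2,1

  cycle⇒2≤k : HamCycle m n → 2 ≤ k
  cycle⇒2≤k (mkHamCycle _ isCycle) = recompute (2 ≤? k) (≤-pred (proj₁ (proj₁ (proj₂ isCycle))))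

  closure : ¬ (m ≡ 2 × n ≡ 1) → DPath m n → HamCycle m n
  closure m,n≢2,1 (mkDPath c isPath ends) = mkHamCycle (edgeSet (lookup c))
    (c , (path⇒3≤mn c m,n≢2,1 ends , proj₁ isPath , proj₂ isPath , λ i j i≡0 j≡k → ≢-sym (ends i j i≡0 j≡k)) ,
     λ u v → ⇔-sym (CycleEdge⇔Edge c u v) ⇔-∘ does≡true⇔ (Edge? (lookup c) u v))

  Represents : (V → V → Bool) → Vec V (m * n) → Set
  Represents E c = IsHamCycle (lookup c) × (∀ u v → E u v ≡ edgeSet (lookup c) u v)

  Represents? : ∀ E c → Dec (Represents E c)
  Represents? E c = IsHamCycle? (lookup c) ×-dec
    ↔-all? vertices (λ u → ↔-all? vertices (λ v → E u v Bool.≟ edgeSet (lookup c) u v))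

  -- The defining cycle of C is irrelevant; an exhaustive search over all vertex
  -- sequences recovers one.  The searches are opaque so that the typechecker never
  -- tries to unfold them.
  opaque
    representative : (C : HamCycle m n) → ∃ (Represents (edges C))
    representative (mkHamCycle E isCycle) =
      recompute (↔-any? (Fin-^-↔ vertices (m * n)) (Represents? E)) (represents isCycle)
      where
      represents : IsHamCycleEdgeSet m n E → ∃ (Represents E)
      represents (c , (_ , eachOnce , consec , wrap) , E⇔) =
        c , (proj₁ eachOnce , cyclicallyAdjacent c consec wrap) ,
        λ u v → bool-≡-does (E u v) (Edge? (lookup c) u v) (CycleEdge⇔Edge c u v ⇔-∘ E⇔ u v)

  module FiberOver (m,n≢2,1 : ¬ (m ≡ 2 × n ≡ 1)) (C : HamCycle m n) where

    private
      c : Seq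
      c = lookup (proj₁ (representative C))

      c-ham : IsHamCycle c
      c-ham = proj₁ (proj₂ (representative C))

      edges≡ : ∀ u v → edges C u v ≡ edgeSet c u v
      edges≡ = proj₂ (proj₂ (representative C))

      2≤k : 2 ≤ k
      2≤k = cycle⇒2≤k C

    Label : Set
    Label = Fin 2 × Fin (m * n)

    pathAt : Label → Vec V (m * n)
    pathAt (b , j) = tabulate (dihedral b j c)

    pathAt-ham : ∀ l → IsHamCycle (lookup (pathAt l))
    pathAt-ham (b , j) = IsHamCycle-cong (λ t → sym (lookup∘tabulate (dihedral b j c) t))
      (Injective-dihedral b j c (proj₁ c-ham) , CyclicallyRelated-dihedral {Adj} ≢-sym b j c (proj₂ c-ham))

    pathAt-injective : ∀ {l l′} → pathAt l ≡ pathAt l′ → l ≡ l′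
    pathAt-injective {b , j} {b′ , j′} same = dihedral-free 2≤k (proj₁ c-ham) b j b′ j′ λ t → begin
      dihedral b j c t            ≡⟨ lookup∘tabulate (dihedral b j c) t ⟨
      lookup (pathAt (b , j)) t   ≡⟨ cong (λ v → lookup v t) same ⟩
      lookup (pathAt (b′ , j′)) t ≡⟨ lookup∘tabulate (dihedral b′ j′ c) t ⟩
      dihedral b′ j′ c t          ∎
      where open ≡-Reasoning

    dpathAt : Label → DPath m n
    dpathAt l = mkDPath (pathAt l) (proj₁ (hamCycle⇒path (pathAt l) (pathAt-ham l)))
                                   (proj₂ (hamCycle⇒path (pathAt l) (pathAt-ham l)))

    closure-dpathAt : ∀ l → closure m,n≢2,1 (dpathAt l) ≈C C
    closure-dpathAt (b , j) u v = trans
      (edgeSet-cong (lookup (pathAt (b , j))) c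
        (Edge-dihedral⁻ b j c ∘ Edge-cong (lookup∘tabulate (dihedral b j c)))
        (Edge-cong (λ t → sym (lookup∘tabulate (dihedral b j c) t)) ∘ Edge-dihedral⁺ b j c) u v)
      (sym (edges≡ u v))

    label-exists : ∀ p → IsDirHamPath m n p → (ends : FirstLastRel DiffPart p) →
                   (∀ u v → edgeSet (lookup p) u v ≡ edges C u v) → ∃ λ l → p ≡ pathAt l
    label-exists p isPath ends over
      with cycle-rigidity 2≤k (proj₁ (path⇒hamCycle p isPath ends)) (proj₁ c-ham) p⊆c
      where
      p⊆c : ∀ {u v} → Edge (lookup p) u v → Edge c u v
      p⊆c {u} {v} e = does⇒ (Edge? c u v)
        (trans (sym (edges≡ u v)) (trans (sym (over u v)) (dec-true (Edge? (lookup p) u v) e)))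
    ... | b , j , p≗ = (b , j) ,
      ≗-lookup⇒≡ p (pathAt (b , j)) (λ t → trans (p≗ t) (sym (lookup∘tabulate (dihedral b j c) t)))

    opaque
      labelOf : ∀ p → .(∃ λ l → p ≡ pathAt l) → ∃ λ l → p ≡ pathAt l
      labelOf p = recompute (↔-any? (*↔× {2} {m * n}) (λ l → Vec.≡-dec _≟V_ p (pathAt l)))

    toFiber : Label → Fiber (closure m,n≢2,1) C
    toFiber l = mkFiber (dpathAt l) (closure-dpathAt l)

    fromFiber : Fiber (closure m,n≢2,1) C → Label
    fromFiber (mkFiber (mkDPath p isPath ends) over) = proj₁ (labelOf p (label-exists p isPath ends over))

    fromFiber∘toFiber : ∀ l → fromFiber (toFiber l) ≡ l
    fromFiber∘toFiber l = sym (pathAt-injective (proj₂ (labelOf (pathAt l) (l , refl))))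

    toFiber∘fromFiber : ∀ x → toFiber (fromFiber x) ≡ x
    toFiber∘fromFiber (mkFiber (mkDPath p isPath ends) over) =
      Fiber-≡ (sym (proj₂ (labelOf p (label-exists p isPath ends over))))

    Fiber↔Label : Fiber (closure m,n≢2,1) C ↔ Label
    Fiber↔Label = mk↔ₛ′ fromFiber toFiber fromFiber∘toFiber toFiber∘fromFiber

Word↔DPath : ∀ m n → Word m n ↔ DPath m n
Word↔DPath m n = mk↔ₛ′ (λ { (mkWord w eachOnce consec ends) → mkDPath w (eachOnce , consec) ends })
                       (λ { (mkDPath p isPath ends) → mkWord p (proj₁ isPath) (proj₂ isPath) ends })
                       (λ _ → refl) (λ _ → refl)

module _ {m n h} (f : DPath m n → HamCycle m n) (cycles : Inverse (setoid (Fin h)) (HamCycleSetoid m n)) where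

  DPath↔ΣFiber : DPath m n ↔ Σ (Fin h) (λ i → Fiber f (to cycles i))
  DPath↔ΣFiber = mk↔ₛ′
    (λ p → from cycles (f p) , mkFiber p (λ u v → sym (strictlyInverseˡ cycles (f p) u v)))
    (λ (_ , x) → Fiber.point x)
    (λ { (i , mkFiber p over) → Σ-fiber-≡ (recompute (from cycles (f p) ≟ i)
                                   (trans (Inverse.from-cong cycles over) (strictlyInverseʳ cycles i))) })
    (λ _ → refl)
    where
    Σ-fiber-≡ : ∀ {i i′ p} .{o o′} → i ≡ i′ →
                _≡_ {A = Σ (Fin h) (λ i → Fiber f (to cycles i))} (i , mkFiber p o) (i′ , mkFiber p o′)
    Σ-fiber-≡ refl = refl

  count-by-fibers : ∀ {d w} → (∀ C → Fiber f C ↔ Fin d) → (Fin w ↔ Word m n) → d * h ≡ w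
  count-by-fibers {d} fibers words = trans (*-comm d h) (↔-card paths words)
    where
    paths : Fin (h * d) ↔ Word m n
    paths = ↔-sym (Word↔DPath m n) ↔-∘ (↔-sym DPath↔ΣFiber ↔-∘ (Σ-↔ ↔-refl (↔-sym (fibers _)) ↔-∘ *↔×))

count-by-colourings : ∀ {m n w s} → (Fin w ↔ Word m n) → (Fin s ↔ ColourWord m n) → w ≡ (n !) ^ m * s
count-by-colourings {m} {n} {s = s} words colourWords = trans (↔-card words colourings) (*-comm s ((n !) ^ m))
  where
  colourings : Fin (s * (n !) ^ m) ↔ Word m n
  colourings = ↔-sym (Colouring.Word↔Colouring m n) ↔-∘ Fin-*-↔ colourWords (Fin-^-↔ (Fin-!-↔ n) m)

mainTheorem5 : (m n : ℕ) → 1 ≤ m → 1 ≤ n → ¬ (m ≡ 2 × n ≡ 1) →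
    (Word m n ↔ DPath m n)
    × Σ (DPath m n → HamCycle m n) (λ f → (C : HamCycle m n) → Fiber f C ↔ Fin (2 * m * n))
    × ((h w s : ℕ) → Inverse (setoid (Fin h)) (HamCycleSetoid m n) → (Fin w ↔ Word m n) →
         (Fin s ↔ ColourWord m n) → (2 * m * n * h ≡ w) × (w ≡ (n !) ^ m * s))
mainTheorem5 zero     n        () _  _
mainTheorem5 (suc m′) zero     _  () _
mainTheorem5 (suc m′) (suc n′) _  _  m,n≢2,1 =
  Word↔DPath m n , (closure m,n≢2,1 , fibers) ,
  λ h w s cycles words colourWords →
    count-by-fibers (closure m,n≢2,1) cycles fibers words , count-by-colourings words colourWords
  where
  open Hamiltonian m′ n′
  fibers : (C : HamCycle m n) → Fiber (closure m,n≢2,1) C ↔ Fin (2 * m * n)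
  fibers C = subst (λ d → FiberOver.Label m,n≢2,1 C ↔ Fin d) (sym (*-assoc 2 m n)) (↔-sym *↔×)
             ↔-∘ FiberOver.Fiber↔Label m,n≢2,1 C
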